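{- Let $k\ge 4$ be an integer and let $\mathcal{S}_k$ be the graph with incoming vertices $i_1,\dots,i_k$ and outgoing vertices $o_1,\dots,o_k$ defined below. Then for every $j=1,\dots,k$ there is a Hamiltonian path in $\mathcal{S}_k$ from $i_j$ to $o_j$.
   Context: A Hamiltonian path from $u$ to $w$ in a directed graph is a directed simple path starting at $u$, ending at $w$, visiting every vertex exactly once. "Undirected edge $(a,b)$" below means both directed edges $(a,b)$ and $(b,a)$. The directed graph $\mathcal{S}_k$ ($k\ge4$) has vertex set $\{1,2,\dots,2k-1\}$ and edges as follows. For even $k\ge4$: undirected edges $(4i-2,4i-1)$, $(4i-1,4i)$, $(4i,4i+1)$ for $i=1,\dots,\frac{k-2}{2}$; directed edges $(4i-2,4i+5)$ and $(4i+1,4i+2)$ for $i=1,\dots,\frac{k-4}{2}$; directed edges $(1,2)$, $(2k-6,2k-1)$, $(2k-3,2k-2)$, $(2k-2,1)$, $(2k-2,5)$, $(2k-1,2k-2)$. For odd $k\ge5$: undirected edges $(4i-2,4i-1)$, $(4i-1,4i)$, $(4i,4i+1)$ for $i=1,\dots,\frac{k-1}{2}$; directed edges $(4i-2,4i+5)$ and $(4i+1,4i+2)$ for $i=1,\dots,\frac{k-3}{2}$; directed edges $(1,2)$, $(2k-4,1)$, $(2k-2,5)$. In both cases the incoming vertices are $i_j=2j-1$ for $j=1,\dots,k$, and the outgoing vertices satisfy $o_{2j}=4j+3$ and $o_{2j+1}=4j-3$ for $j=1,\dots,\lfloor\frac{k-3}{2}\rfloor$; in addition, for even $k$: $o_1=3$,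 $o_{k-2}=2k-1$, $o_{k-1}=2k-7$, $o_k=2k-3$; for odd $k$: $o_1=2k-1$, $o_{k-1}=3$, $o_k=2k-5$. -}

module Defs where

open import Data.Nat using (ℕ; zero; suc; _+_; _*_; _∸_; _≤_; _%_)
open import Data.Product using (Σ; _×_; _,_)
open import Data.Sum using (_⊎_)
open import Data.List using (List; []; _∷_)
open import Data.List.Membership.Propositional using (_∈_)
open import Data.List.Relation.Unary.All using (All)
open import Data.List.Relation.Unary.Unique.Propositional using (Unique)
open import Relation.Binary.PropositionalEquality using (_≡_)

IsVertex : ℕ → ℕ → Set
IsVertex k v = 1 ≤ v × v ≤ 2 * k ∸ 1

data EdgeE (k : ℕ) : ℕ → ℕ → Set where
  -- undirected edges (4i-2,4i-1), (4i-1,4i), (4i,4i+1), i = 1..(k-2)/2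
  ua  : ∀ {i} → 1 ≤ i → 2 * i ≤ k ∸ 2 → EdgeE k (4 * i ∸ 2) (4 * i ∸ 1)
  ua' : ∀ {i} → 1 ≤ i → 2 * i ≤ k ∸ 2 → EdgeE k (4 * i ∸ 1) (4 * i ∸ 2)
  ub  : ∀ {i} → 1 ≤ i → 2 * i ≤ k ∸ 2 → EdgeE k (4 * i ∸ 1) (4 * i)
  ub' : ∀ {i} → 1 ≤ i → 2 * i ≤ k ∸ 2 → EdgeE k (4 * i) (4 * i ∸ 1)
  uc  : ∀ {i} → 1 ≤ i → 2 * i ≤ k ∸ 2 → EdgeE k (4 * i) (4 * i + 1)
  uc' : ∀ {i} → 1 ≤ i → 2 * i ≤ k ∸ 2 → EdgeE k (4 * i + 1) (4 * i)
  da  : ∀ {i} → 1 ≤ i → 2 * i ≤ k ∸ 4 → EdgeE k (4 * i ∸ 2) (4 * i + 5)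
  db  : ∀ {i} → 1 ≤ i → 2 * i ≤ k ∸ 4 → EdgeE k (4 * i + 1) (4 * i + 2)
  s1 : EdgeE k 1 2
  s2 : EdgeE k (2 * k ∸ 6) (2 * k ∸ 1)
  s3 : EdgeE k (2 * k ∸ 3) (2 * k ∸ 2)
  s4 : EdgeE k (2 * k ∸ 2) 1
  s5 : EdgeE k (2 * k ∸ 2) 5
  s6 : EdgeE k (2 * k ∸ 1) (2 * k ∸ 2)

data EdgeO (k : ℕ) : ℕ → ℕ → Set where
  -- undirected edges (4i-2,4i-1), (4i-1,4i), (4i,4i+1), i = 1..(k-1)/2
  ua  : ∀ {i} → 1 ≤ i → 2 * i ≤ k ∸ 1 → EdgeO k (4 * i ∸ 2) (4 * i ∸ 1)
  ua' : ∀ {i} → 1 ≤ i → 2 * i ≤ k ∸ 1 → EdgeO k (4 * i ∸ 1) (4 * i ∸ 2)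
  ub  : ∀ {i} → 1 ≤ i → 2 * i ≤ k ∸ 1 → EdgeO k (4 * i ∸ 1) (4 * i)
  ub' : ∀ {i} → 1 ≤ i → 2 * i ≤ k ∸ 1 → EdgeO k (4 * i) (4 * i ∸ 1)
  uc  : ∀ {i} → 1 ≤ i → 2 * i ≤ k ∸ 1 → EdgeO k (4 * i) (4 * i + 1)
  uc' : ∀ {i} → 1 ≤ i → 2 * i ≤ k ∸ 1 → EdgeO k (4 * i + 1) (4 * i)
  da  : ∀ {i} → 1 ≤ i → 2 * i ≤ k ∸ 3 → EdgeO k (4 * i ∸ 2) (4 * i + 5)
  db  : ∀ {i} → 1 ≤ i → 2 * i ≤ k ∸ 3 → EdgeO k (4 * i + 1) (4 * i + 2)
  s1 : EdgeO k 1 2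
  s2 : EdgeO k (2 * k ∸ 4) 1
  s3 : EdgeO k (2 * k ∸ 2) 5

Edge : ℕ → ℕ → ℕ → Set
Edge k a b = (k % 2 ≡ 0 × EdgeE k a b) ⊎ (k % 2 ≡ 1 × EdgeO k a b)

inVertex : ℕ → ℕ
inVertex j = 2 * j ∸ 1

data OutVertex (k : ℕ) : ℕ → ℕ → Set where
  o-even : ∀ {j} → 1 ≤ j → 2 * j ≤ k ∸ 3 → OutVertex k (2 * j) (4 * j + 3)
  o-odd  : ∀ {j} → 1 ≤ j → 2 * j ≤ k ∸ 3 → OutVertex k (2 * j + 1) (4 * j ∸ 3)
  e1  : k % 2 ≡ 0 → OutVertex k 1 3
  ek2 : k % 2 ≡ 0 → OutVertex k (k ∸ 2) (2 * k ∸ 1)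
  ek1 : k % 2 ≡ 0 → OutVertex k (k ∸ 1) (2 * k ∸ 7)
  ek  : k % 2 ≡ 0 → OutVertex k k (2 * k ∸ 3)
  d1  : k % 2 ≡ 1 → OutVertex k 1 (2 * k ∸ 1)
  dk1 : k % 2 ≡ 1 → OutVertex k (k ∸ 1) 3
  dk  : k % 2 ≡ 1 → OutVertex k k (2 * k ∸ 5)

data Path (E : ℕ → ℕ → Set) : ℕ → ℕ → List ℕ → Set where
  [_]  : ∀ u → Path E u u (u ∷ [])
  _∷ₚ_ : ∀ {u v w vs} → E u v → Path E v w vs → Path E u w (u ∷ vs)

HamiltonianPath : ℕ → ℕ → ℕ → Set
HamiltonianPath k u w =
  Σ (List ℕ) λ vs →
    Path (Edge k) u w vs
    × Unique vs
    × All (IsVertex k) vs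
    × (∀ v → IsVertex k v → v ∈ vs)

-- Write k = 2t + 4 or k = 2t + 3. The vertices 2, …, 4t + 5 of S_k form t + 1 blocks
-- {4c + 2, …, 4c + 5}, each an undirected path, and block c is linked to block c + 1 by the
-- edges 4c + 2 → 4c + 9 and 4c + 5 → 4c + 6. Hence, starting from 1 → 2, one can climb
-- v → v + 1 through any number of blocks, and one can descend 4c + 5 → … → 4c + 2 through a
-- block, jump to the top of the next one and descend again. The remaining edges form a gadget
-- leading from 4t + 2 back to 1 (through 2k − 1 and 2k − 2 when k is even). If i_j is the top
-- of block s, the Hamiltonian path descends from there to the last block, returns to 1 and
-- climbs to o_j = 4s + 1; if i_j = 4s + 3, it first climbs to the bottom of block s + 1, and at
-- the end jumps from block s into block s + 1 to stop at o_j = 4s + 7. The indices j = 1,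
-- k − 2, k − 1, k need a few special paths around vertex 5 and the gadget.

module Submission where

open import Defs
open import Data.Empty using (⊥-elim)
open import Relation.Nullary using (¬_)
open import Data.Nat using (ℕ; zero; suc; _+_; _*_; _∸_; _≤_; _<_; z≤n; s≤s; _%_;
  compare; less; equal; greater)
open import Data.Nat.Properties
open import Data.Nat.DivMod using ([m+kn]%n≡m%n)
open import Data.Nat.Tactic.RingSolver using (solve-∀)
open import Data.Product using (Σ; _×_; _,_)
open import Data.Sum using (inj₁; inj₂)
open import Data.List using (List; []; _∷_; _++_; reverse)
open import Data.List.Relation.Unary.All as All using (All; []; _∷_)
open import Data.List.Relation.Unary.Any using (here; there)
open import Data.List.Relation.Unary.AllPairs using (_∷_)
open import Data.List.Relation.Unary.Unique.Propositional using (Unique; [])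
open import Data.List.Membership.Propositional using (_∈_)
open import Data.List.Relation.Binary.Permutation.Propositional
  using (_↭_; ↭-refl; ↭-sym; ↭-trans; ↭-reflexive; ↭⇒↭ₛ)
open import Data.List.Relation.Binary.Permutation.Propositional.Properties
  using (++⁺; ++-comm; ∈-resp-↭; All-resp-↭; ↭-reverse; ++-commutativeMonoid)
open import Relation.Binary.PropositionalEquality
  using (_≡_; refl; sym; trans; cong; subst; subst₂; setoid)
open import Data.List.Relation.Binary.Permutation.Setoid.Properties (setoid ℕ)
  using (Unique-resp-↭)
import Algebra.Solver.CommutativeMonoid (++-commutativeMonoid {A = ℕ}) as ↭-Solver
open ↭-Solver using (_⊜_; _⊕_)

1+m+n≡o⇒m<o : ∀ {m n o} → suc m + n ≡ o → m < o
1+m+n≡o⇒m<o {m} 1+m+n≡o = m+n≤o⇒m≤o (suc m) (≤-reflexive 1+m+n≡o)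

m+[1+n]≡o⇒m<o : ∀ {m n o} → m + suc n ≡ o → m < o
m+[1+n]≡o⇒m<o {m} m+[1+n]≡o = <-≤-trans (m<m+n m (s≤s z≤n)) (≤-reflexive m+[1+n]≡o)

double-≤ : ∀ {i n} → i ≤ n → 2 * i ≤ n * 2
double-≤ {i} {n} i≤n = subst (2 * i ≤_) (*-comm 2 n) (*-monoʳ-≤ 2 i≤n)

d+[1+m+n]≰n : ∀ d m n → ¬ (d + (suc m + n) ≤ n)
d+[1+m+n]≰n d m n h = 1+n≰n (≤-trans (s≤s (m≤n+m n m)) (m+n≤o⇒n≤o d h))

4*suc : ∀ c → 4 * suc c ≡ 4 + c * 4
4*suc c = trans (*-suc 4 c) (cong (4 +_) (*-comm 4 c))

block-index-≤ : ∀ d {c t} → d + suc (c * 4) ≤ 4 + t * 4 → c ≤ t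
block-index-≤ d {c} {t} h = ≤-pred (*-cancelʳ-< 4 c (suc t) (m+n≤o⇒n≤o d h))

interval : ℕ → ℕ → List ℕ
interval a zero    = []
interval a (suc n) = a ∷ interval (suc a) n

interval-bounded : ∀ a n → All (λ v → a ≤ v × v < a + n) (interval a n)
interval-bounded a zero    = []
interval-bounded a (suc n) =
  (≤-refl , m<m+n a (s≤s z≤n)) ∷
  All.map (λ {v} (a<v , v<) → <⇒≤ a<v , subst (v <_) (sym (+-suc a n)) v<)
          (interval-bounded (suc a) n)

∈-interval : ∀ {a n v} → a ≤ v → v < a + n → v ∈ interval a n
∈-interval {a} {zero}  {v} a≤v v<a+0 = ⊥-elim (<⇒≱ (subst (v <_) (+-identityʳ a) v<a+0) a≤v)
∈-interval {a} {suc n} {v} a≤v v<a+n with m≤n⇒m<n∨m≡n a≤v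
... | inj₂ refl = here refl
... | inj₁ a<v  = there (∈-interval a<v (subst (v <_) (+-suc a n) v<a+n))

interval-unique : ∀ a n → Unique (interval a n)
interval-unique a zero    = []
interval-unique a (suc n) =
  All.map (λ (a<v , _) a≡v → <-irrefl a≡v a<v) (interval-bounded (suc a) n) ∷ interval-unique (suc a) n

infix 4 _Enumerates[_,_⟩
_Enumerates[_,_⟩ : List ℕ → ℕ → ℕ → Set
xs Enumerates[ a , b ⟩ = Σ ℕ λ n → a + n ≡ b × xs ↭ interval a n

interval-enumerates : ∀ {a b} n → a + n ≡ b → interval a n Enumerates[ a , b ⟩
interval-enumerates n a+n≡b = n , a+n≡b , ↭-refl

[]-enumerates : ∀ a → [] Enumerates[ a , a ⟩
[]-enumerates a = 0 , +-identityʳ a , ↭-refl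

reverse-enumerates : ∀ {xs a b} → xs Enumerates[ a , b ⟩ → reverse xs Enumerates[ a , b ⟩
reverse-enumerates {xs} (n , a+n≡b , xs↭) = n , a+n≡b , ↭-trans (↭-reverse xs) xs↭

enumerates-resp-↭ : ∀ {xs ys a b} → xs ↭ ys → ys Enumerates[ a , b ⟩ → xs Enumerates[ a , b ⟩
enumerates-resp-↭ xs↭ys (n , a+n≡b , ys↭) = n , a+n≡b , ↭-trans xs↭ys ys↭

infixr 5 _++ₑ_
_++ₑ_ : ∀ {xs ys a b c} → xs Enumerates[ a , b ⟩ → ys Enumerates[ b , c ⟩ → xs ++ ys Enumerates[ a , c ⟩
_++ₑ_ {a = a} (m , refl , xs↭) (n , refl , ys↭) =
  m + n , sym (+-assoc a m n) , ↭-trans (++⁺ xs↭ ys↭) (↭-reflexive (sym (interval-++ a m n)))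
  where
  interval-++ : ∀ a m n → interval a (m + n) ≡ interval a m ++ interval (a + m) n
  interval-++ a zero    n = cong (λ b → interval b n) (sym (+-identityʳ a))
  interval-++ a (suc m) n = cong (a ∷_) (trans (interval-++ (suc a) m n)
                                                (cong (λ b → interval (suc a) m ++ interval b n) (sym (+-suc a m))))

SpanningPath : (ℕ → ℕ → Set) → ℕ → ℕ → ℕ → Set
SpanningPath E N u w = Σ (List ℕ) λ vs → Path E u w vs × vs Enumerates[ 1 , suc N ⟩

hamiltonian : ∀ {k N u w} → 2 * k ∸ 1 ≡ N → SpanningPath (Edge k) N u w → HamiltonianPath k u w
hamiltonian refl (vs , path , n , 1+n≡ , vs↭) with suc-injective 1+n≡
... | refl =
  vs , path , Unique-resp-↭ (↭⇒↭ₛ (↭-sym vs↭)) (interval-unique 1 n)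
     , All-resp-↭ (↭-sym vs↭) (All.map (λ (1≤v , v<) → 1≤v , ≤-pred v<) (interval-bounded 1 n))
     , λ v (1≤v , v≤n) → ∈-resp-↭ (↭-sym vs↭) (∈-interval 1≤v (s≤s v≤n))

module _ {E : ℕ → ℕ → Set} where

  infixr 5 _▸⟨_⟩_ _⇒_

  _⇒_ : ∀ {u v w vs} → E u v → Path E v w vs → Path E u w (u ∷ vs)
  _⇒_ = _∷ₚ_

  _▸⟨_⟩_ : ∀ {u v w y xs ys} → Path E u v xs → E v w → Path E w y ys → Path E u y (xs ++ ys)
  [ _ ]    ▸⟨ e ⟩ q = e ∷ₚ q
  (e′ ∷ₚ p) ▸⟨ e ⟩ q = e′ ∷ₚ (p ▸⟨ e ⟩ q)

  ascent : ∀ {a b} n → a + n ≡ b → (∀ {v} → a ≤ v → v < b → E v (suc v)) →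
           Path E a b (interval a (suc n))
  ascent {a} zero    a+0≡b _    = subst (λ b → Path E a b (a ∷ [])) (trans (sym (+-identityʳ a)) a+0≡b) [ a ]
  ascent {a} (suc n) a+n≡b step =
    step ≤-refl (<-≤-trans (m<m+n a (s≤s z≤n)) (≤-reflexive a+n≡b))
    ∷ₚ ascent n (trans (sym (+-suc a n)) a+n≡b) (λ a<v → step (<⇒≤ a<v))

data Position : ℕ → Set where
  start : Position 1
  at₂   : ∀ c → Position (2 + c * 4)
  at₃   : ∀ c → Position (3 + c * 4)
  at₄   : ∀ c → Position (4 + c * 4)
  at₅   : ∀ c → Position (5 + c * 4)

position : ∀ n → Position (suc n)
position 0 = start
position 1 = at₂ 0
position 2 = at₃ 0
position 3 = at₄ 0
position (suc (suc (suc (suc n)))) with position n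
... | start = at₅ 0
... | at₂ c = at₂ (suc c)
... | at₃ c = at₃ (suc c)
... | at₄ c = at₄ (suc c)
... | at₅ c = at₅ (suc c)

blocksDescending : ℕ → ℕ → List ℕ
blocksDescending c zero    = []
blocksDescending c (suc n) = 5 + c * 4 ∷ 4 + c * 4 ∷ 3 + c * 4 ∷ 2 + c * 4 ∷ blocksDescending (suc c) n

blocksDescending-enumerates : ∀ c n {d} → c + n ≡ d → blocksDescending c n Enumerates[ 2 + c * 4 , 2 + d * 4 ⟩
blocksDescending-enumerates c zero    c+0≡d = subst (λ d → [] Enumerates[ 2 + c * 4 , 2 + d * 4 ⟩)
                                                    (trans (sym (+-identityʳ c)) c+0≡d) ([]-enumerates _)
blocksDescending-enumerates c (suc n) c+n≡d =
  reverse-enumerates (interval-enumerates 4 (+-comm (2 + c * 4) 4))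
  ++ₑ blocksDescending-enumerates (suc c) n (trans (sym (+-suc c n)) c+n≡d)

-- edgeₘₙ is the edge family (4i + m − 4, 4i + n − 4) of S_k, i.e. m + 4c → n + 4c with c = i − 1.
record BlockChain (E : ℕ → ℕ → Set) (t : ℕ) : Set where
  field
    edge₂₃ : ∀ {i} → 1 ≤ i → i ≤ suc t → E (4 * i ∸ 2) (4 * i ∸ 1)
    edge₃₂ : ∀ {i} → 1 ≤ i → i ≤ suc t → E (4 * i ∸ 1) (4 * i ∸ 2)
    edge₃₄ : ∀ {i} → 1 ≤ i → i ≤ suc t → E (4 * i ∸ 1) (4 * i)
    edge₄₃ : ∀ {i} → 1 ≤ i → i ≤ suc t → E (4 * i) (4 * i ∸ 1)
    edge₄₅ : ∀ {i} → 1 ≤ i → i ≤ suc t → E (4 * i) (4 * i + 1)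
    edge₅₄ : ∀ {i} → 1 ≤ i → i ≤ suc t → E (4 * i + 1) (4 * i)
    edge₂₉ : ∀ {i} → 1 ≤ i → i ≤ t → E (4 * i ∸ 2) (4 * i + 5)
    edge₅₆ : ∀ {i} → 1 ≤ i → i ≤ t → E (4 * i + 1) (4 * i + 2)
    edge₁₂ : E 1 2

module Blocks {E : ℕ → ℕ → Set} {t : ℕ} (B : BlockChain E t) where

  private
    module B = BlockChain B

    4*suc+ : ∀ c d → 4 * suc c + d ≡ 4 + d + c * 4
    4*suc+ = solve-∀

  up₂ : ∀ {c} → c ≤ t → E (2 + c * 4) (3 + c * 4)
  up₂ {c} h = subst₂ E (cong (_∸ 2) (4*suc c)) (cong (_∸ 1) (4*suc c)) (B.edge₂₃ (s≤s z≤n) (s≤s h))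

  up₃ : ∀ {c} → c ≤ t → E (3 + c * 4) (4 + c * 4)
  up₃ {c} h = subst₂ E (cong (_∸ 1) (4*suc c)) (4*suc c) (B.edge₃₄ (s≤s z≤n) (s≤s h))

  up₄ : ∀ {c} → c ≤ t → E (4 + c * 4) (5 + c * 4)
  up₄ {c} h = subst₂ E (4*suc c) (4*suc+ c 1) (B.edge₄₅ (s≤s z≤n) (s≤s h))

  up₅ : ∀ {c} → c < t → E (5 + c * 4) (6 + c * 4)
  up₅ {c} h = subst₂ E (4*suc+ c 1) (4*suc+ c 2) (B.edge₅₆ (s≤s z≤n) h)

  down₅ : ∀ {c} → c ≤ t → E (5 + c * 4) (4 + c * 4)
  down₅ {c} h = subst₂ E (4*suc+ c 1) (4*suc c) (B.edge₅₄ (s≤s z≤n) (s≤s h))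

  down₄ : ∀ {c} → c ≤ t → E (4 + c * 4) (3 + c * 4)
  down₄ {c} h = subst₂ E (4*suc c) (cong (_∸ 1) (4*suc c)) (B.edge₄₃ (s≤s z≤n) (s≤s h))

  down₃ : ∀ {c} → c ≤ t → E (3 + c * 4) (2 + c * 4)
  down₃ {c} h = subst₂ E (cong (_∸ 1) (4*suc c)) (cong (_∸ 2) (4*suc c)) (B.edge₃₂ (s≤s z≤n) (s≤s h))

  jump : ∀ {c} → c < t → E (2 + c * 4) (9 + c * 4)
  jump {c} h = subst₂ E (cong (_∸ 2) (4*suc c)) (4*suc+ c 5) (B.edge₂₉ (s≤s z≤n) h)

  rise : ∀ {v} → 1 ≤ v → v < 5 + t * 4 → E v (suc v)
  rise {suc n} _ = step (position n)
    where
    step : ∀ {v} → Position v → v < 5 + t * 4 → E v (suc v)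
    step start   _       = B.edge₁₂
    step (at₂ c) (s≤s h) = up₂ (block-index-≤ 1 {c} h)
    step (at₃ c) (s≤s h) = up₃ (block-index-≤ 2 {c} h)
    step (at₄ c) (s≤s h) = up₄ (block-index-≤ 3 {c} h)
    step (at₅ c) (s≤s h) = up₅ (block-index-≤ 0 {suc c} h)

  climb : ∀ {a b} n → 1 ≤ a → a + n ≡ b → b ≤ 5 + t * 4 → Path E a b (interval a (suc n))
  climb n 1≤a a+n≡b b≤top = ascent n a+n≡b (λ a≤v v<b → rise (≤-trans 1≤a a≤v) (<-≤-trans v<b b≤top))

  descendFrom₅ : ∀ {c d} n → c + n ≡ d → d ≤ t →
                 Path E (5 + c * 4) (2 + d * 4) (blocksDescending c (suc n))
  descendFrom₂ : ∀ {c d} n → c + n ≡ d → d ≤ t →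
                 Path E (2 + c * 4) (2 + d * 4) (2 + c * 4 ∷ blocksDescending (suc c) n)

  descendFrom₅ {c} n c+n≡d d≤t = down₅ c≤t ⇒ down₄ c≤t ⇒ down₃ c≤t ⇒ descendFrom₂ n c+n≡d d≤t
    where
    c≤t : c ≤ t
    c≤t = ≤-trans (m+n≤o⇒m≤o c (≤-reflexive c+n≡d)) d≤t

  descendFrom₂ {c} zero    c+0≡d _   = subst (λ d → Path E (2 + c * 4) (2 + d * 4) (2 + c * 4 ∷ []))
                                             (trans (sym (+-identityʳ c)) c+0≡d) [ _ ]
  descendFrom₂ {c} (suc n) c+n≡d d≤t =
    jump (<-≤-trans (m+[1+n]≡o⇒m<o c+n≡d) d≤t)
    ⇒ descendFrom₅ n (trans (sym (+-suc c n)) c+n≡d) d≤t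

module ChainWithGadget {E : ℕ → ℕ → Set} {t : ℕ} (B : BlockChain E t) (N : ℕ)
  (gadget : List ℕ) (gadget-enumerates : gadget Enumerates[ 6 + t * 4 , suc N ⟩)
  (exit : ∀ {u y xs ys} → Path E u (2 + t * 4) xs → Path E 1 y ys → Path E u y (xs ++ gadget ++ ys))
  where

  open Blocks B public

  evenIndexPath : ∀ s r → suc s + r ≡ t → SpanningPath E N (3 + s * 4) (7 + s * 4)
  evenIndexPath s r 1+s+r≡t = _ , path , enumerates-resp-↭ reorder segments
    where
    x : ℕ
    x = s * 4
    s<t : s < t
    s<t = 1+m+n≡o⇒m<o 1+s+r≡t
    x≤T : x ≤ t * 4
    x≤T = *-monoˡ-≤ 4 (<⇒≤ s<t)
    path =
      climb 2 (s≤s z≤n) (+-comm (3 + x) 2) (+-monoʳ-≤ 5 x≤T)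
      ▸⟨ up₅ s<t ⟩
      exit (descendFrom₂ r 1+s+r≡t ≤-refl)
           (climb (1 + x) (s≤s z≤n) refl (+-mono-≤ (s≤s (s≤s z≤n)) x≤T)
            ▸⟨ jump s<t ⟩ (down₅ s<t ⇒ down₄ s<t ⇒ [ 7 + x ]))
    segments =
      interval-enumerates (2 + x) refl
      ++ₑ interval-enumerates 3 (+-comm (3 + x) 3)
      ++ₑ interval-enumerates 1 (+-comm (6 + x) 1)
      ++ₑ reverse-enumerates (interval-enumerates 3 (+-comm (7 + x) 3))
      ++ₑ blocksDescending-enumerates (2 + s) r (cong suc 1+s+r≡t)
      ++ₑ gadget-enumerates
    reorder = ↭-Solver.solve 6
      (λ A B C D F G → A ⊕ (B ⊕ (C ⊕ (D ⊕ (F ⊕ G)))) ⊜ F ⊕ (A ⊕ (B ⊕ (G ⊕ (C ⊕ D))))) ↭-refl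
      (interval (3 + x) 3) (6 + x ∷ []) (blocksDescending (2 + s) r) gadget
      (interval 1 (2 + x)) (9 + x ∷ 8 + x ∷ 7 + x ∷ [])

  oddIndexPath : ∀ s n → s + n ≡ t → SpanningPath E N (5 + s * 4) (1 + s * 4)
  oddIndexPath s n s+n≡t = _ , path , enumerates-resp-↭ reorder segments
    where
    x : ℕ
    x = s * 4
    path = exit (descendFrom₅ n s+n≡t ≤-refl)
                (climb x (s≤s z≤n) refl (+-mono-≤ (s≤s z≤n) (*-monoˡ-≤ 4 (m+n≤o⇒m≤o s (≤-reflexive s+n≡t)))))
    segments =
      interval-enumerates (1 + x) refl
      ++ₑ blocksDescending-enumerates s (suc n) (trans (+-suc s n) (cong suc s+n≡t))
      ++ₑ gadget-enumerates
    reorder = ↭-Solver.solve 3 (λ A B C → A ⊕ (B ⊕ C) ⊜ C ⊕ (A ⊕ B)) ↭-refl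
      (blocksDescending s (suc n)) gadget (interval 1 (1 + x))

data Parity : ℕ → Set where
  even : ∀ h → Parity (h * 2)
  odd  : ∀ h → Parity (1 + h * 2)

parity : ∀ n → Parity n
parity zero          = even 0
parity (suc zero)    = odd 0
parity (suc (suc n)) with parity n
... | even h = even (suc h)
... | odd h  = odd (suc h)

-- The position of j ≥ 1 relative to the blocks 0 … t: the incoming vertex i_j is 3 + 4s for
-- j = 2s + 2 and 5 + 4s for j = 2s + 3.
data Index (t : ℕ) : ℕ → Set where
  first     : Index t 1
  evenBelow : ∀ s r → suc s + r ≡ t → Index t (suc s * 2)
  evenAt    : Index t (suc t * 2)
  evenAbove : ∀ d → Index t (d * 2 + (4 + t * 2))
  oddBelow  : ∀ s r → s + suc r ≡ t → Index t (3 + s * 2)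
  oddAt     : Index t (3 + t * 2)
  oddAbove  : ∀ d → Index t (d * 2 + (5 + t * 2))

index-oddAbove : ∀ t d → d * 2 + (5 + t * 2) ≡ 3 + suc (t + d) * 2
index-oddAbove = solve-∀

index-evenAbove : ∀ t d → d * 2 + (4 + t * 2) ≡ suc (suc (t + d)) * 2
index-evenAbove = solve-∀

index : ∀ t j → Index t (suc j)
index t j with parity j
... | even zero    = first
... | even (suc s) with compare s t
...   | less _ r    = oddBelow s r (+-suc s r)
...   | equal _     = oddAt
...   | greater _ d = subst (Index t) (index-oddAbove t d) (oddAbove d)
index t j | odd h with compare h t
...   | less _ r    = evenBelow h r refl
...   | equal _     = evenAt
...   | greater _ d = subst (Index t) (index-evenAbove t d) (evenAbove d)

data KView : ℕ → Set where
  evenK : ∀ t → KView (4 + t * 2)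
  oddK  : ∀ w → KView (5 + w * 2)

kView : ∀ {k} → 4 ≤ k → KView k
kView {k} 4≤k with parity k | 4≤k
... | even (suc (suc t)) | _                  = evenK t
... | odd (suc (suc w))  | _                  = oddK w
... | even 0             | ()
... | even 1             | s≤s (s≤s ())
... | odd 0              | s≤s ()
... | odd 1              | s≤s (s≤s (s≤s ()))

inVertex-even : ∀ s → inVertex (suc s * 2) ≡ 3 + s * 4
inVertex-even s = cong (_∸ 1) (4+4s s)
  where
  4+4s : ∀ s → 2 * (suc s * 2) ≡ 4 + s * 4
  4+4s = solve-∀

inVertex-odd : ∀ s → inVertex (3 + s * 2) ≡ 5 + s * 4
inVertex-odd s = cong (_∸ 1) (6+4s s)
  where
  6+4s : ∀ s → 2 * (3 + s * 2) ≡ 6 + s * 4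
  6+4s = solve-∀

outVertex-even : ∀ {k s} → suc s * 2 ≤ k ∸ 3 → OutVertex k (suc s * 2) (7 + s * 4)
outVertex-even {k} {s} h =
  subst₂ (OutVertex k) (*-comm 2 (suc s)) (7+4s s)
         (o-even (s≤s z≤n) (subst (_≤ k ∸ 3) (*-comm (suc s) 2) h))
  where
  7+4s : ∀ s → 4 * suc s + 3 ≡ 7 + s * 4
  7+4s = solve-∀

outVertex-odd : ∀ {k s} → suc s * 2 ≤ k ∸ 3 → OutVertex k (3 + s * 2) (1 + s * 4)
outVertex-odd {k} {s} h =
  subst₂ (OutVertex k) (3+2s s) (cong (_∸ 3) (4*suc s))
         (o-odd (s≤s z≤n) (subst (_≤ k ∸ 3) (*-comm (suc s) 2) h))
  where
  3+2s : ∀ s → 2 * suc s + 1 ≡ 3 + s * 2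
  3+2s = solve-∀

Solution : ℕ → ℕ → Set
Solution k j = Σ ℕ λ o → OutVertex k j o × HamiltonianPath k (inVertex j) o

toSolution : ∀ {k j o u w} → OutVertex k j o → inVertex j ≡ u → o ≡ w →
             HamiltonianPath k u w → Solution k j
toSolution out refl refl ham = _ , out , ham

module EvenGraph (t : ℕ) where

  k : ℕ
  k = 4 + t * 2

  private
    T : ℕ
    T = t * 4

    twice-k : 2 * k ≡ 8 + T
    twice-k = 8+4t t
      where
      8+4t : ∀ t → 2 * (4 + t * 2) ≡ 8 + t * 4
      8+4t = solve-∀

    isEven : k % 2 ≡ 0
    isEven = [m+kn]%n≡m%n 4 t 2

    edge : ∀ {a b} → EdgeE k a b → Edge k a b
    edge e = inj₁ (isEven , e)

    -- The bounds k ∸ 2 and k ∸ 4 of the constructors compute to suc t * 2 and t * 2.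
    blockChain : BlockChain (Edge k) t
    blockChain = record
      { edge₂₃ = λ p q → edge (ua p (double-≤ q))
      ; edge₃₂ = λ p q → edge (ua' p (double-≤ q))
      ; edge₃₄ = λ p q → edge (ub p (double-≤ q))
      ; edge₄₃ = λ p q → edge (ub' p (double-≤ q))
      ; edge₄₅ = λ p q → edge (uc p (double-≤ q))
      ; edge₅₄ = λ p q → edge (uc' p (double-≤ q))
      ; edge₂₉ = λ p q → edge (da p (double-≤ q))
      ; edge₅₆ = λ p q → edge (db p (double-≤ q))
      ; edge₁₂ = edge s1
      }

    jumpToLast : Edge k (2 + T) (7 + T)
    jumpToLast = edge (subst₂ (EdgeE k) (cong (_∸ 6) twice-k) (cong (_∸ 1) twice-k) s2)

    topStep : Edge k (5 + T) (6 + T)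
    topStep = edge (subst₂ (EdgeE k) (cong (_∸ 3) twice-k) (cong (_∸ 2) twice-k) s3)

    returnTo1 : Edge k (6 + T) 1
    returnTo1 = edge (subst (λ n → EdgeE k (n ∸ 2) 1) twice-k s4)

    returnTo5 : Edge k (6 + T) 5
    returnTo5 = edge (subst (λ n → EdgeE k (n ∸ 2) 5) twice-k s5)

    lastStep : Edge k (7 + T) (6 + T)
    lastStep = edge (subst₂ (EdgeE k) (cong (_∸ 1) twice-k) (cong (_∸ 2) twice-k) s6)

    open ChainWithGadget blockChain (7 + T) (7 + T ∷ 6 + T ∷ [])
                (reverse-enumerates (interval-enumerates 2 (+-comm (6 + T) 2)))
                (λ p q → p ▸⟨ jumpToLast ⟩ (lastStep ⇒ returnTo1 ⇒ q))

    pathFor1 : SpanningPath (Edge k) (7 + T) 1 3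
    pathFor1 = _ , path , enumerates-resp-↭ reorder segments
      where
      path = edge s1 ⇒ (descendFrom₂ {0} t refl ≤-refl ▸⟨ jumpToLast ⟩
                        (lastStep ⇒ returnTo5 ⇒ down₅ z≤n ⇒ down₄ z≤n ⇒ [ 3 ]))
      segments =
        interval-enumerates 2 refl
        ++ₑ reverse-enumerates (interval-enumerates 3 refl)
        ++ₑ blocksDescending-enumerates 1 t refl
        ++ₑ reverse-enumerates (interval-enumerates 2 (+-comm (6 + T) 2))
      reorder = ↭-Solver.solve 4 (λ A B C D → A ⊕ (B ⊕ (C ⊕ D)) ⊜ A ⊕ (D ⊕ (B ⊕ C))) ↭-refl
        (1 ∷ 2 ∷ []) (blocksDescending 1 t) (7 + T ∷ 6 + T ∷ []) (5 ∷ 4 ∷ 3 ∷ [])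

    pathForKMinus2 : SpanningPath (Edge k) (7 + T) (3 + T) (7 + T)
    pathForKMinus2 = _ , path , enumerates-resp-↭ reorder segments
      where
      path = climb 2 (s≤s z≤n) (+-comm (3 + T) 2) ≤-refl ▸⟨ topStep ⟩
             (returnTo1 ⇒ (climb (1 + T) (s≤s z≤n) refl (+-monoˡ-≤ T (s≤s (s≤s z≤n)))
                           ▸⟨ jumpToLast ⟩ [ 7 + T ]))
      segments =
        interval-enumerates (2 + T) refl
        ++ₑ interval-enumerates 3 (+-comm (3 + T) 3)
        ++ₑ interval-enumerates 2 (+-comm (6 + T) 2)
      reorder = ↭-Solver.solve 4 (λ A B C D → A ⊕ (B ⊕ (C ⊕ D)) ⊜ C ⊕ (A ⊕ (B ⊕ D))) ↭-refl
        (interval (3 + T) 3) (6 + T ∷ []) (interval 1 (2 + T)) (7 + T ∷ [])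

    pathForK : SpanningPath (Edge k) (7 + T) (7 + T) (5 + T)
    pathForK = _ , lastStep ⇒ returnTo1 ⇒ climb (4 + T) (s≤s z≤n) refl ≤-refl
                 , enumerates-resp-↭ (++-comm (7 + T ∷ 6 + T ∷ []) (interval 1 (5 + T)))
                     (interval-enumerates (5 + T) refl
                      ++ₑ reverse-enumerates (interval-enumerates 2 (+-comm (6 + T) 2)))

    solutionFrom : ∀ {j o u w} → OutVertex k j o → inVertex j ≡ u → o ≡ w →
                   SpanningPath (Edge k) (7 + T) u w → Solution k j
    solutionFrom out in≡u o≡w p = toSolution out in≡u o≡w (hamiltonian (cong (_∸ 1) twice-k) p)

  solution : ∀ {j} → Index t j → j ≤ k → Solution k j
  solution first                 _   = solutionFrom (e1 isEven) refl refl pathFor1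
  solution (evenBelow s r 1+s+r≡t) _ =
    solutionFrom (outVertex-even {s = s} (m≤n⇒m≤1+n (*-monoˡ-≤ 2 (1+m+n≡o⇒m<o {s} 1+s+r≡t))))
        (inVertex-even s) refl (evenIndexPath s r 1+s+r≡t)
  solution evenAt                _   =
    solutionFrom (ek2 isEven) (inVertex-even t) (cong (_∸ 1) twice-k) pathForKMinus2
  solution (evenAbove zero)      _   =
    solutionFrom (ek isEven) (cong (_∸ 1) twice-k) (cong (_∸ 3) twice-k) pathForK
  solution (evenAbove (suc d))   j≤k = ⊥-elim (d+[1+m+n]≰n 0 (suc (d * 2)) k j≤k)
  solution (oddBelow s r s+r≡t)  _   =
    solutionFrom (outVertex-odd {s = s} (m≤n⇒m≤1+n (*-monoˡ-≤ 2 (m+[1+n]≡o⇒m<o s+r≡t))))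
        (inVertex-odd s) refl (oddIndexPath s (suc r) s+r≡t)
  solution oddAt                 _   =
    solutionFrom (ek1 isEven) (inVertex-odd t) (cong (_∸ 7) twice-k) (oddIndexPath t 0 (+-identityʳ t))
  solution (oddAbove d)          j≤k = ⊥-elim (d+[1+m+n]≰n (d * 2) 0 k j≤k)

module OddGraph (w : ℕ) where

  t : ℕ
  t = suc w

  k : ℕ
  k = 3 + t * 2

  private
    U : ℕ
    U = t * 4

    twice-k : 2 * k ≡ 6 + U
    twice-k = 6+4t t
      where
      6+4t : ∀ t → 2 * (3 + t * 2) ≡ 6 + t * 4
      6+4t = solve-∀

    isOdd : k % 2 ≡ 1
    isOdd = [m+kn]%n≡m%n 3 t 2

    edge : ∀ {a b} → EdgeO k a b → Edge k a b
    edge e = inj₂ (isOdd , e)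

    -- The bounds k ∸ 1 and k ∸ 3 of the constructors compute to suc t * 2 and t * 2.
    blockChain : BlockChain (Edge k) t
    blockChain = record
      { edge₂₃ = λ p q → edge (ua p (double-≤ q))
      ; edge₃₂ = λ p q → edge (ua' p (double-≤ q))
      ; edge₃₄ = λ p q → edge (ub p (double-≤ q))
      ; edge₄₃ = λ p q → edge (ub' p (double-≤ q))
      ; edge₄₅ = λ p q → edge (uc p (double-≤ q))
      ; edge₅₄ = λ p q → edge (uc' p (double-≤ q))
      ; edge₂₉ = λ p q → edge (da p (double-≤ q))
      ; edge₅₆ = λ p q → edge (db p (double-≤ q))
      ; edge₁₂ = edge s1
      }

    returnTo1 : Edge k (2 + U) 1
    returnTo1 = edge (subst (λ n → EdgeO k (n ∸ 4) 1) twice-k s2)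

    returnTo5 : Edge k (4 + U) 5
    returnTo5 = edge (subst (λ n → EdgeO k (n ∸ 2) 5) twice-k s3)

    open ChainWithGadget blockChain (5 + U) [] ([]-enumerates _) (λ p q → p ▸⟨ returnTo1 ⟩ q)

    pathFor1 : SpanningPath (Edge k) (5 + U) 1 (5 + U)
    pathFor1 = _ , climb (4 + U) (s≤s z≤n) refl ≤-refl , interval-enumerates (5 + U) refl

    pathForKMinus1 : SpanningPath (Edge k) (5 + U) (3 + U) 3
    pathForKMinus1 = _ , path , enumerates-resp-↭ reorder segments
      where
      path = down₃ ≤-refl ⇒ returnTo1 ⇒ edge s1 ⇒
             (descendFrom₂ {0} w refl (n≤1+n w) ▸⟨ jump ≤-refl ⟩
              (down₅ ≤-refl ⇒ returnTo5 ⇒ down₅ z≤n ⇒ down₄ z≤n ⇒ [ 3 ]))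
      segments =
        interval-enumerates 2 refl
        ++ₑ reverse-enumerates (interval-enumerates 3 refl)
        ++ₑ blocksDescending-enumerates 1 w refl
        ++ₑ reverse-enumerates (interval-enumerates 2 (+-comm (2 + U) 2))
        ++ₑ reverse-enumerates (interval-enumerates 2 (+-comm (4 + U) 2))
      reorder = ↭-Solver.solve 5
        (λ A B C D F → A ⊕ (B ⊕ (C ⊕ (D ⊕ F))) ⊜ B ⊕ (F ⊕ (C ⊕ (A ⊕ D)))) ↭-refl
        (3 + U ∷ 2 + U ∷ []) (1 ∷ 2 ∷ []) (blocksDescending 1 w) (5 + U ∷ 4 + U ∷ []) (5 ∷ 4 ∷ 3 ∷ [])

    solutionFrom : ∀ {j o u w} → OutVertex k j o → inVertex j ≡ u → o ≡ w →
                   SpanningPath (Edge k) (5 + U) u w → Solution k j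
    solutionFrom out in≡u o≡w p = toSolution out in≡u o≡w (hamiltonian (cong (_∸ 1) twice-k) p)

  solution : ∀ {j} → Index t j → j ≤ k → Solution k j
  solution first                 _   = solutionFrom (d1 isOdd) refl (cong (_∸ 1) twice-k) pathFor1
  solution (evenBelow s r 1+s+r≡t) _ =
    solutionFrom (outVertex-even {s = s} (*-monoˡ-≤ 2 (1+m+n≡o⇒m<o {s} 1+s+r≡t)))
        (inVertex-even s) refl (evenIndexPath s r 1+s+r≡t)
  solution evenAt                _   = solutionFrom (dk1 isOdd) (inVertex-even t) refl pathForKMinus1
  solution (evenAbove d)         j≤k = ⊥-elim (d+[1+m+n]≰n (d * 2) 0 k j≤k)
  solution (oddBelow s r s+r≡t)  _   =
    solutionFrom (outVertex-odd {s = s} (*-monoˡ-≤ 2 (m+[1+n]≡o⇒m<o s+r≡t)))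
        (inVertex-odd s) refl (oddIndexPath s (suc r) s+r≡t)
  solution oddAt                 _   =
    solutionFrom (dk isOdd) (inVertex-odd t) (cong (_∸ 5) twice-k) (oddIndexPath t 0 (+-identityʳ t))
  solution (oddAbove d)          j≤k = ⊥-elim (d+[1+m+n]≰n (d * 2) 1 k j≤k)

proposition2 : (k : ℕ) → 4 ≤ k → (j : ℕ) → 1 ≤ j → j ≤ k →
    Σ ℕ λ o → OutVertex k j o × HamiltonianPath k (inVertex j) o
proposition2 k 4≤k zero    ()  j≤k
proposition2 k 4≤k (suc j) _   j≤k with kView 4≤k
... | evenK t = EvenGraph.solution t (index t j) j≤k
... | oddK w  = OddGraph.solution w (index (suc w) j) j≤k
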